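{- For integers $0\le d\le n$ define $$g_{n,d}(t)=\sum_{i=1}^{\min(d,n-d)} \frac{(n-i-1)!}{(d-i)!\,(n-d-i)!\,(i-1)!}\, t^i$$ (an empty sum being $0$; so $g_{d,d}(t)=0$, $g_{d+1,d}(t)=t$, $g_{d+2,d}(t)=dt+(d-1)t^2$). Then for all $d\ge 1$ and $n\ge d+2$, $$g_{n,d}(t)=\frac{(2d-n+1)t+n-2}{n-d-1}\, g_{n-1,d}(t)+\frac{t(n-d-2)}{n-d-1}\, g_{n-2,d}(t),$$ $$g_{n,d}(t)=\frac{dt+n-1}{n-d-1}\, g_{n-1,d}(t)-\frac{t(t+1)}{n-d-1}\, g_{n-1,d}'(t).$$
   Context: $g_{n,d}$ is Speyer's $g$-polynomial of the uniform matroid $U_{n,d}$; $g'$ denotes the derivative in $t$. -}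

module Defs where

open import Data.Nat using (ℕ; zero; suc; _∸_; _≤ᵇ_; _!) renaming (_*_ to _*ℕ_)
open import Data.Integer using (ℤ; +_)
open import Data.Rational using (ℚ; 0ℚ; _/_; _+_; _*_)
open import Data.Bool using (_∧_; if_then_else_)

-- Division of a rational by a natural number; only ever used with a
-- nonzero divisor (the value at divisor 0 is an irrelevant convention).
_/ℕ_ : ℚ → ℕ → ℚ
q /ℕ zero = 0ℚ
q /ℕ suc k = q * (+ 1 / suc k)

ℕ→ℚ : ℕ → ℚ
ℕ→ℚ k = + k / 1

ℤ→ℚ : ℤ → ℚ
ℤ→ℚ z = z / 1

-- Polynomials in t over ℚ, represented by their coefficient sequence
-- (coefficient of t^k at index k).  Equality of polynomials = pointwise.
Poly : Set
Poly = ℕ → ℚ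

infixl 6 _⊕_
infixr 7 _⊙_

_⊕_ : Poly → Poly → Poly
(p ⊕ q) k = p k + q k

_⊙_ : ℚ → Poly → Poly
(c ⊙ p) k = c * p k

tX : Poly → Poly
tX p zero = 0ℚ
tX p (suc k) = p k

deriv : Poly → Poly
deriv p k = ℕ→ℚ (suc k) * p (suc k)

-- Speyer's g-polynomial of the uniform matroid U_{n,d}:
-- g_{n,d}(t) = Σ_{i=1}^{min(d,n-d)} (n-i-1)! / ((d-i)! (n-d-i)! (i-1)!) t^i
g : ℕ → ℕ → Poly
g n d i =
  if (1 ≤ᵇ i) ∧ (i ≤ᵇ d) ∧ (i ≤ᵇ (n ∸ d))
  then ℕ→ℚ ((n ∸ i ∸ 1) !) /ℕ (((d ∸ i) !) *ℕ ((n ∸ d ∸ i) !) *ℕ ((i ∸ 1) !))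
  else 0ℚ

{-# OPTIONS --safe #-}
-- The coefficient of t^k in g_{d+e,d} is the multinomial coefficient
-- (d+e-k-1)! / ((d-k)! (e-k)! (k-1)!), read as 0 as soon as one of the three lower
-- indices is negative.  Extended by zero in this way it satisfies, for all d, e, k and
-- without boundary cases, the absorption identity
--   (e+1-k) [t^k] g_{d+e+1,d} = (d+e-k) [t^k] g_{d+e,d}
-- and the exchange identity
--   k [t^(k+1)] g_{d+e+1,d} = (d-k) [t^k] g_{d+e,d}.
-- For e = n-d-1, absorption at degree k plus exchange at degree k-1 is the second
-- recurrence multiplied by n-d-1; the same two identities at e = n-d-2 turn it into
-- the first recurrence.

module Submission where

open import Defs
open import Data.Nat using (ℕ; _≤_; _∸_) renaming (_+_ to _+ℕ_; _*_ to _*ℕ_)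
open import Data.Integer using (+_) renaming (_+_ to _+ℤ_; _-_ to _-ℤ_)
open import Data.Rational using (ℚ; -_)
open import Data.Product using (_×_; _,_)
open import Relation.Binary.PropositionalEquality using (_≡_; refl; cong)

module MultinomialCoefficients where

  open import Data.Nat
  open import Data.Nat.Properties
  open import Data.Nat.Combinatorics using (_C_; nCk≡n!/k![n-k]!; k![n∸k]!∣n!)
  open import Data.Nat.DivMod using (m/n*n≡m)
  open import Data.Nat.Tactic.RingSolver using (solve-∀)
  open import Relation.Binary.PropositionalEquality
  open ≡-Reasoning

  nCk*[k!*[n∸k]!]≡n! : ∀ {n k} → k ≤ n → (n C k) * (k ! * (n ∸ k) !) ≡ n !
  nCk*[k!*[n∸k]!]≡n! {n} {k} k≤n = begin
    (n C k) * (k ! * (n ∸ k) !)                  ≡⟨ cong (_* (k ! * (n ∸ k) !)) (nCk≡n!/k![n-k]! k≤n) ⟩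
    n ! / (k ! * (n ∸ k) !) * (k ! * (n ∸ k) !)  ≡⟨ m/n*n≡m (k![n∸k]!∣n! k≤n) ⟩
    n !                                          ∎
    where instance _ = k !* (n ∸ k) !≢0

  [m+n]Cn*[n!*m!]≡[m+n]! : ∀ m n → ((m + n) C n) * (n ! * m !) ≡ (m + n) !
  [m+n]Cn*[n!*m!]≡[m+n]! m n =
    subst (λ o → ((m + n) C n) * (n ! * o !) ≡ (m + n) !) (m+n∸n≡m m n) (nCk*[k!*[n∸k]!]≡n! (m≤n+m n m))

  multinomial : ℕ → ℕ → ℕ → ℕ
  multinomial a b c = ((a + b + c) C c) * ((a + b) C b)

  a!*b!*c!*multinomial≡[a+b+c]! : ∀ a b c → a ! * b ! * c ! * multinomial a b c ≡ (a + b + c) !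
  a!*b!*c!*multinomial≡[a+b+c]! a b c = begin
    a ! * b ! * c ! * (((a + b + c) C c) * ((a + b) C b))     ≡⟨ regroup (a !) (b !) (c !) ((a + b + c) C c) ((a + b) C b) ⟩
    ((a + b + c) C c) * (c ! * (((a + b) C b) * (b ! * a !))) ≡⟨ cong (λ x → ((a + b + c) C c) * (c ! * x)) ([m+n]Cn*[n!*m!]≡[m+n]! a b) ⟩
    ((a + b + c) C c) * (c ! * (a + b) !)                     ≡⟨ [m+n]Cn*[n!*m!]≡[m+n]! (a + b) c ⟩
    (a + b + c) !                                             ∎
    where
    regroup : ∀ x y z u v → x * y * z * (u * v) ≡ u * (z * (v * (y * x)))
    regroup = solve-∀

  multinomial-from-factorials : ∀ a b c m → a ! * b ! * c ! * m ≡ suc (a + b + c) ! →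
                                m ≡ suc (a + b + c) * multinomial a b c
  multinomial-from-factorials a b c m eq = *-cancelˡ-≡ m _ (a ! * b ! * c !) (begin
    a ! * b ! * c ! * m                                     ≡⟨ eq ⟩
    suc (a + b + c) * (a + b + c) !                         ≡⟨ cong (suc (a + b + c) *_) (a!*b!*c!*multinomial≡[a+b+c]! a b c) ⟨
    suc (a + b + c) * (a ! * b ! * c ! * multinomial a b c) ≡⟨ swap (suc (a + b + c)) (a ! * b ! * c !) (multinomial a b c) ⟩
    a ! * b ! * c ! * (suc (a + b + c) * multinomial a b c) ∎)
    where
    instance
      a!*b!*c!≢0 : NonZero (a ! * b ! * c !)
      a!*b!*c!≢0 = m*n≢0 (a ! * b !) (c !) {{a !* b !≢0}} {{c !≢0}}
    swap : ∀ x y z → x * (y * z) ≡ y * (x * z)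
    swap = solve-∀

  multinomial-absorbˡ : ∀ a b c → suc a * multinomial (suc a) b c ≡ suc (a + b + c) * multinomial a b c
  multinomial-absorbˡ a b c = multinomial-from-factorials a b c _ (begin
    a ! * b ! * c ! * (suc a * multinomial (suc a) b c) ≡⟨ regroup (a !) (b !) (c !) (suc a) (multinomial (suc a) b c) ⟩
    suc a ! * b ! * c ! * multinomial (suc a) b c       ≡⟨ a!*b!*c!*multinomial≡[a+b+c]! (suc a) b c ⟩
    suc (a + b + c) !                                   ∎)
    where
    regroup : ∀ x y z s m → x * y * z * (s * m) ≡ s * x * y * z * m
    regroup = solve-∀

  multinomial-absorbᵐ : ∀ a b c → suc b * multinomial a (suc b) c ≡ suc (a + b + c) * multinomial a b c
  multinomial-absorbᵐ a b c = multinomial-from-factorials a b c _ (begin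
    a ! * b ! * c ! * (suc b * multinomial a (suc b) c) ≡⟨ regroup (a !) (b !) (c !) (suc b) (multinomial a (suc b) c) ⟩
    a ! * suc b ! * c ! * multinomial a (suc b) c       ≡⟨ a!*b!*c!*multinomial≡[a+b+c]! a (suc b) c ⟩
    (a + suc b + c) !                                   ≡⟨ cong (λ x → (x + c) !) (+-suc a b) ⟩
    suc (a + b + c) !                                   ∎)
    where
    regroup : ∀ x y z s m → x * y * z * (s * m) ≡ x * (s * y) * z * m
    regroup = solve-∀

  multinomial-absorbʳ : ∀ a b c → suc c * multinomial a b (suc c) ≡ suc (a + b + c) * multinomial a b c
  multinomial-absorbʳ a b c = multinomial-from-factorials a b c _ (begin
    a ! * b ! * c ! * (suc c * multinomial a b (suc c)) ≡⟨ regroup (a !) (b !) (c !) (suc c) (multinomial a b (suc c)) ⟩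
    a ! * b ! * suc c ! * multinomial a b (suc c)       ≡⟨ a!*b!*c!*multinomial≡[a+b+c]! a b (suc c) ⟩
    (a + b + suc c) !                                   ≡⟨ cong _! (+-suc (a + b) c) ⟩
    suc (a + b + c) !                                   ∎)
    where
    regroup : ∀ x y z s m → x * y * z * (s * m) ≡ x * y * (s * z) * m
    regroup = solve-∀

open MultinomialCoefficients

module CoefficientIdentities where

  open import Data.Nat as ℕ using (zero; suc; _≤?_)
  open import Data.Nat.Properties using (+-∸-assoc; m≤n⇒m∸n≡0; ≰⇒>; <⇒≤)
  open import Data.Integer using (ℤ; 0ℤ; 1ℤ; -1ℤ; _+_; _-_; _*_)
  open import Data.Integer.Properties using (pos-*; *-zeroʳ; ⊖-≥; m-n≡m⊖n)
  open import Data.Integer.Tactic.RingSolver using (solve-∀)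
  open import Relation.Nullary using (yes; no)
  open import Relation.Binary.PropositionalEquality
  open ≡-Reasoning

  -- + (m ℕ.+ n) reduces to + m + + n, so the ring identities over integer variables in the
  -- where-blocks below apply to casts such as + suc (d ℕ.+ j) by plain instantiation.

  pos-∸ : ∀ {m n} → n ≤ m → + (m ∸ n) ≡ + m - + n
  pos-∸ {m} {n} n≤m = trans (sym (⊖-≥ n≤m)) (sym (m-n≡m⊖n m n))

  pos-*-cong : ∀ a b c d → a ℕ.* b ≡ c ℕ.* d → + a * + b ≡ + c * + d
  pos-*-cong a b c d eq = trans (sym (pos-* a b)) (trans (cong +_ eq) (pos-* c d))

  -- An index 0 of multinomial₁ stands for the index -1 of multinomial, where it vanishes.
  multinomial₁ : ℕ → ℕ → ℕ → ℤ
  multinomial₁ zero    _       _       = 0ℤ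
  multinomial₁ (suc a) zero    _       = 0ℤ
  multinomial₁ (suc a) (suc b) zero    = 0ℤ
  multinomial₁ (suc a) (suc b) (suc c) = + multinomial a b c

  multinomial₁-exchange : ∀ x y z → + z * multinomial₁ x y (suc z) ≡ + x * multinomial₁ (suc x) y z
  multinomial₁-exchange zero    y       z       = *-zeroʳ (+ z)
  multinomial₁-exchange (suc a) zero    z       = trans (*-zeroʳ (+ z)) (sym (*-zeroʳ (+ suc a)))
  multinomial₁-exchange (suc a) (suc b) zero    = sym (*-zeroʳ (+ suc a))
  multinomial₁-exchange (suc a) (suc b) (suc c) =
    pos-*-cong (suc c) _ (suc a) _ (trans (multinomial-absorbʳ a b c) (sym (multinomial-absorbˡ a b c)))

  multinomial₁-absorption : ∀ a y z →
    + y * multinomial₁ (suc a) (suc y) z ≡ (+ a + + y + + z - 1ℤ) * multinomial₁ (suc a) y z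
  multinomial₁-absorption a zero    z       = sym (*-zeroʳ (+ a + + 0 + + z - 1ℤ))
  multinomial₁-absorption a (suc b) zero    = trans (*-zeroʳ (+ suc b)) (sym (*-zeroʳ (+ a + + suc b + + 0 - 1ℤ)))
  multinomial₁-absorption a (suc b) (suc c) = begin
    + suc b * + multinomial a (suc b) c                   ≡⟨ pos-*-cong (suc b) _ (suc (a ℕ.+ b ℕ.+ c)) _ (multinomial-absorbᵐ a b c) ⟩
    + suc (a ℕ.+ b ℕ.+ c) * + multinomial a b c           ≡⟨ cong (_* + multinomial a b c) (total (+ a) (+ b) (+ c)) ⟩
    (+ a + + suc b + + suc c - 1ℤ) * + multinomial a b c  ∎
    where
    total : ∀ A B C → + 1 + (A + B + C) ≡ A + (+ 1 + B) + (+ 1 + C) - 1ℤ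
    total = solve-∀

  coefficient : ℕ → ℕ → ℕ → ℤ
  coefficient d e k = multinomial₁ (suc d ∸ k) (suc e ∸ k) k

  coefficient-exchange : ∀ d e k → + k * coefficient d (suc e) (suc k) ≡ (+ d - + k) * coefficient d e k
  coefficient-exchange d e k with k ≤? d
  ... | yes k≤d rewrite +-∸-assoc 1 k≤d =
    trans (multinomial₁-exchange (d ∸ k) (suc e ∸ k) k) (cong (_* multinomial₁ (suc (d ∸ k)) (suc e ∸ k) k) (pos-∸ k≤d))
  ... | no k≰d rewrite m≤n⇒m∸n≡0 (<⇒≤ (≰⇒> k≰d)) | m≤n⇒m∸n≡0 (≰⇒> k≰d) =
    trans (*-zeroʳ (+ k)) (sym (*-zeroʳ (+ d - + k)))

  coefficient-absorption : ∀ d e k →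
    (+ suc e - + k) * coefficient d (suc e) k ≡ (+ d + + e - + k) * coefficient d e k
  coefficient-absorption d e k with k ≤? d | k ≤? suc e
  ... | no k≰d | _ rewrite m≤n⇒m∸n≡0 (≰⇒> k≰d) =
    trans (*-zeroʳ (+ suc e - + k)) (sym (*-zeroʳ (+ d + + e - + k)))
  ... | yes k≤d | no k≰e rewrite +-∸-assoc 1 k≤d | m≤n⇒m∸n≡0 (≰⇒> k≰e) | m≤n⇒m∸n≡0 (<⇒≤ (≰⇒> k≰e)) =
    trans (*-zeroʳ (+ suc e - + k)) (sym (*-zeroʳ (+ d + + e - + k)))
  ... | yes k≤d | yes k≤e rewrite +-∸-assoc 1 k≤d | +-∸-assoc 1 k≤e = begin
    (+ suc e - + k) * multinomial₁ (suc a) (suc y) k   ≡⟨ cong (_* multinomial₁ (suc a) (suc y) k) (pos-∸ k≤e) ⟨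
    + y * multinomial₁ (suc a) (suc y) k               ≡⟨ multinomial₁-absorption a y k ⟩
    (+ a + + y + + k - 1ℤ) * multinomial₁ (suc a) y k  ≡⟨ cong (_* multinomial₁ (suc a) y k) total ⟩
    (+ d + + e - + k) * multinomial₁ (suc a) y k       ∎
    where
    a y : ℕ
    a = d ∸ k
    y = suc e ∸ k
    total : + a + + y + + k - 1ℤ ≡ + d + + e - + k
    total = trans (cong₂ (λ A Y → A + Y + + k - 1ℤ) (pos-∸ k≤d) (pos-∸ k≤e)) (regroup (+ d) (+ e) (+ k))
      where
      regroup : ∀ D E K → (D - K) + (+ 1 + E - K) + K - 1ℤ ≡ D + E - K
      regroup = solve-∀

  coefficient-recurrence₂ : ∀ d j z →
    + suc j * coefficient d (suc (suc j)) (suc z)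
      ≡ + d * coefficient d (suc j) z + + suc (d ℕ.+ j) * coefficient d (suc j) (suc z)
        + -1ℤ * (+ z * coefficient d (suc j) z + + suc z * coefficient d (suc j) (suc z))
  coefficient-recurrence₂ d j z = begin
    + suc j * G                                                    ≡⟨ split (+ j) (+ z) G ⟩
    (+ suc (suc j) - + suc z) * G + + z * G                        ≡⟨ cong₂ _+_ (coefficient-absorption d (suc j) (suc z))
                                                                                (coefficient-exchange d (suc j) z) ⟩
    (+ d + + suc j - + suc z) * Y + (+ d - + z) * X                ≡⟨ regroup (+ d) (+ j) (+ z) X Y ⟩
    + d * X + + suc (d ℕ.+ j) * Y + -1ℤ * (+ z * X + + suc z * Y)  ∎
    where
    G X Y : ℤ
    G = coefficient d (suc (suc j)) (suc z)
    X = coefficient d (suc j) z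
    Y = coefficient d (suc j) (suc z)
    split : ∀ J Z G → (+ 1 + J) * G ≡ (+ 1 + (+ 1 + J) - (+ 1 + Z)) * G + Z * G
    split = solve-∀
    regroup : ∀ D J Z X Y → (D + (+ 1 + J) - (+ 1 + Z)) * Y + (D - Z) * X
                          ≡ D * X + (+ 1 + (D + J)) * Y + -1ℤ * (Z * X + (+ 1 + Z) * Y)
    regroup = solve-∀

  coefficient-recurrence₁ : ∀ d j z →
    + suc j * coefficient d (suc (suc j)) (suc z)
      ≡ (+ (2 ℕ.* d) + + 1 - + suc (suc (d ℕ.+ j))) * coefficient d (suc j) z
        + + (d ℕ.+ j) * coefficient d (suc j) (suc z) + + j * coefficient d j z
  coefficient-recurrence₁ d j z = begin
    + suc j * coefficient d (suc (suc j)) (suc z)                        ≡⟨ coefficient-recurrence₂ d j z ⟩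
    + d * X + + suc (d ℕ.+ j) * Y + -1ℤ * (+ z * X + + suc z * Y)       ≡⟨ regroup (+ d) (+ j) (+ z) X Y ⟩
    C * X + + (d ℕ.+ j) * Y + ((+ suc j - + z) * X - + z * Y)           ≡⟨ cong₂ (λ u v → C * X + + (d ℕ.+ j) * Y + (u - v))
                                                                                   (coefficient-absorption d j z) (coefficient-exchange d j z) ⟩
    C * X + + (d ℕ.+ j) * Y + ((+ d + + j - + z) * Z - (+ d - + z) * Z) ≡⟨ cancel C (+ d) (+ j) (+ z) X Y Z ⟩
    C * X + + (d ℕ.+ j) * Y + + j * Z                                    ≡⟨ cong (λ c → (c + + 1 - + suc (suc (d ℕ.+ j))) * X + + (d ℕ.+ j) * Y + + j * Z)
                                                                                 (pos-* 2 d) ⟨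
    (+ (2 ℕ.* d) + + 1 - + suc (suc (d ℕ.+ j))) * X + + (d ℕ.+ j) * Y + + j * Z ∎
    where
    C X Y Z : ℤ
    C = + 2 * + d + + 1 - + suc (suc (d ℕ.+ j))
    X = coefficient d (suc j) z
    Y = coefficient d (suc j) (suc z)
    Z = coefficient d j z
    regroup : ∀ D J Z X Y → D * X + (+ 1 + (D + J)) * Y + -1ℤ * (Z * X + (+ 1 + Z) * Y)
                          ≡ (+ 2 * D + + 1 - (+ 1 + (+ 1 + (D + J)))) * X + (D + J) * Y + ((+ 1 + J - Z) * X - Z * Y)
    regroup = solve-∀
    cancel : ∀ C D J Z X Y W → C * X + (D + J) * Y + ((D + J - Z) * W - (D - Z) * W) ≡ C * X + (D + J) * Y + J * W
    cancel = solve-∀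

open CoefficientIdentities

module RationalEmbedding where

  open import Data.Nat as ℕ using (suc)
  open import Data.Integer as ℤ using (ℤ)
  open import Data.Integer.Tactic.RingSolver using (solve-∀)
  open import Data.Rational using (0ℚ; 1ℚ; _/_; _+_; _*_; toℚᵘ)
  open import Data.Rational.Properties using (toℚᵘ-injective; toℚᵘ-fromℚᵘ; toℚᵘ-homo-+; toℚᵘ-homo-*; *-identityʳ; *-comm; *-assoc)
  open import Data.Rational.Solver using (module +-*-Solver)
  import Data.Rational.Unnormalised as ℚᵘ
  import Data.Rational.Unnormalised.Properties as ℚᵘ
  open import Relation.Binary.PropositionalEquality

  toℚᵘ-ℤ→ℚ : ∀ i → toℚᵘ (ℤ→ℚ i) ℚᵘ.≃ ℚᵘ.mkℚᵘ i 0
  toℚᵘ-ℤ→ℚ i = toℚᵘ-fromℚᵘ (ℚᵘ.mkℚᵘ i 0)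

  ℤ→ℚ-homo-+ : ∀ i j → ℤ→ℚ (i ℤ.+ j) ≡ ℤ→ℚ i + ℤ→ℚ j
  ℤ→ℚ-homo-+ i j = toℚᵘ-injective (begin
    toℚᵘ (ℤ→ℚ (i ℤ.+ j))            ≈⟨ toℚᵘ-ℤ→ℚ (i ℤ.+ j) ⟩
    ℚᵘ.mkℚᵘ (i ℤ.+ j) 0             ≈⟨ ℚᵘ.*≡* (sum i j) ⟩
    ℚᵘ.mkℚᵘ i 0 ℚᵘ.+ ℚᵘ.mkℚᵘ j 0    ≈⟨ ℚᵘ.+-cong (toℚᵘ-ℤ→ℚ i) (toℚᵘ-ℤ→ℚ j) ⟨
    toℚᵘ (ℤ→ℚ i) ℚᵘ.+ toℚᵘ (ℤ→ℚ j)  ≈⟨ toℚᵘ-homo-+ (ℤ→ℚ i) (ℤ→ℚ j) ⟨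
    toℚᵘ (ℤ→ℚ i + ℤ→ℚ j)            ∎)
    where
    open ℚᵘ.≃-Reasoning
    sum : ∀ i j → (i ℤ.+ j) ℤ.* + 1 ≡ (i ℤ.* + 1 ℤ.+ j ℤ.* + 1) ℤ.* + 1
    sum = solve-∀

  ℤ→ℚ-homo-* : ∀ i j → ℤ→ℚ (i ℤ.* j) ≡ ℤ→ℚ i * ℤ→ℚ j
  ℤ→ℚ-homo-* i j = toℚᵘ-injective (begin
    toℚᵘ (ℤ→ℚ (i ℤ.* j))            ≈⟨ toℚᵘ-ℤ→ℚ (i ℤ.* j) ⟩
    ℚᵘ.mkℚᵘ i 0 ℚᵘ.* ℚᵘ.mkℚᵘ j 0    ≈⟨ ℚᵘ.*-cong (toℚᵘ-ℤ→ℚ i) (toℚᵘ-ℤ→ℚ j) ⟨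
    toℚᵘ (ℤ→ℚ i) ℚᵘ.* toℚᵘ (ℤ→ℚ j)  ≈⟨ toℚᵘ-homo-* (ℤ→ℚ i) (ℤ→ℚ j) ⟨
    toℚᵘ (ℤ→ℚ i * ℤ→ℚ j)            ∎)
    where open ℚᵘ.≃-Reasoning

  ℕ→ℚ-*-inverse : ∀ k → ℕ→ℚ (suc k) * (+ 1 / suc k) ≡ 1ℚ
  ℕ→ℚ-*-inverse k = toℚᵘ-injective (begin
    toℚᵘ (ℕ→ℚ (suc k) * (+ 1 / suc k))          ≈⟨ toℚᵘ-homo-* (ℕ→ℚ (suc k)) (+ 1 / suc k) ⟩
    toℚᵘ (ℕ→ℚ (suc k)) ℚᵘ.* toℚᵘ (+ 1 / suc k)  ≈⟨ ℚᵘ.*-cong (toℚᵘ-ℤ→ℚ (+ suc k)) (toℚᵘ-fromℚᵘ (ℚᵘ.mkℚᵘ (+ 1) k)) ⟩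
    ℚᵘ.mkℚᵘ (+ suc k) 0 ℚᵘ.* ℚᵘ.mkℚᵘ (+ 1) k    ≈⟨ ℚᵘ.*-inverseʳ (ℚᵘ.mkℚᵘ (+ suc k) 0) ⟩
    ℚᵘ.1ℚᵘ                                      ∎)
    where open ℚᵘ.≃-Reasoning

  *-/ℕ-cancelˡ : ∀ m q .{{_ : ℕ.NonZero m}} → (ℕ→ℚ m * q) /ℕ m ≡ q
  *-/ℕ-cancelˡ (suc k) q = begin
    ℕ→ℚ (suc k) * q * (+ 1 / suc k)    ≡⟨ cong (_* (+ 1 / suc k)) (*-comm (ℕ→ℚ (suc k)) q) ⟩
    q * ℕ→ℚ (suc k) * (+ 1 / suc k)    ≡⟨ *-assoc q (ℕ→ℚ (suc k)) (+ 1 / suc k) ⟩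
    q * (ℕ→ℚ (suc k) * (+ 1 / suc k))  ≡⟨ cong (q *_) (ℕ→ℚ-*-inverse k) ⟩
    q * 1ℚ                             ≡⟨ *-identityʳ q ⟩
    q                                  ∎
    where open ≡-Reasoning

  ℤ→ℚ-divide : ∀ k a b c {G X Y Z : ℚ} {g x y z : ℤ} →
    G ≡ ℤ→ℚ g → X ≡ ℤ→ℚ x → Y ≡ ℤ→ℚ y → Z ≡ ℤ→ℚ z →
    + suc k ℤ.* g ≡ a ℤ.* x ℤ.+ b ℤ.* y ℤ.+ c ℤ.* z →
    G ≡ (ℤ→ℚ a /ℕ suc k) * X + (ℤ→ℚ b /ℕ suc k) * Y + (ℤ→ℚ c /ℕ suc k) * Z
  ℤ→ℚ-divide k a b c {g = g} {x} {y} {z} refl refl refl refl relation = begin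
    ℤ→ℚ g                                                ≡⟨ *-/ℕ-cancelˡ (suc k) (ℤ→ℚ g) ⟨
    (ℕ→ℚ (suc k) * ℤ→ℚ g) /ℕ suc k                       ≡⟨ cong (_/ℕ suc k) (ℤ→ℚ-homo-* (+ suc k) g) ⟨
    ℤ→ℚ (+ suc k ℤ.* g) /ℕ suc k                         ≡⟨ cong (λ w → ℤ→ℚ w /ℕ suc k) relation ⟩
    ℤ→ℚ (a ℤ.* x ℤ.+ b ℤ.* y ℤ.+ c ℤ.* z) /ℕ suc k       ≡⟨ cong (_/ℕ suc k) linear ⟩
    (A * ℤ→ℚ x + B * ℤ→ℚ y + C * ℤ→ℚ z) * r              ≡⟨ distribute A (ℤ→ℚ x) B (ℤ→ℚ y) C (ℤ→ℚ z) r ⟩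
    (A * r) * ℤ→ℚ x + (B * r) * ℤ→ℚ y + (C * r) * ℤ→ℚ z  ∎
    where
    open ≡-Reasoning
    open +-*-Solver
    A B C r : ℚ
    A = ℤ→ℚ a
    B = ℤ→ℚ b
    C = ℤ→ℚ c
    r = + 1 / suc k
    linear : ℤ→ℚ (a ℤ.* x ℤ.+ b ℤ.* y ℤ.+ c ℤ.* z) ≡ A * ℤ→ℚ x + B * ℤ→ℚ y + C * ℤ→ℚ z
    linear = trans (ℤ→ℚ-homo-+ (a ℤ.* x ℤ.+ b ℤ.* y) (c ℤ.* z))
      (cong₂ _+_ (trans (ℤ→ℚ-homo-+ (a ℤ.* x) (b ℤ.* y)) (cong₂ _+_ (ℤ→ℚ-homo-* a x) (ℤ→ℚ-homo-* b y))) (ℤ→ℚ-homo-* c z))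
    distribute : ∀ A X B Y C Z r → (A * X + B * Y + C * Z) * r ≡ (A * r) * X + (B * r) * Y + (C * r) * Z
    distribute = solve 7 (λ A X B Y C Z r → (A :* X :+ B :* Y :+ C :* Z) :* r := (A :* r) :* X :+ (B :* r) :* Y :+ (C :* r) :* Z) refl

  0≡p*0+q*0+r*0 : ∀ p q r → 0ℚ ≡ p * 0ℚ + q * 0ℚ + r * 0ℚ
  0≡p*0+q*0+r*0 = solve 3 (λ p q r → con 0ℚ := p :* con 0ℚ :+ q :* con 0ℚ :+ r :* con 0ℚ) refl
    where open +-*-Solver

open RationalEmbedding

module GRecurrences where

  open import Data.Nat as ℕ using (zero; suc; _≤ᵇ_; _!)
  open import Data.Nat.Properties using (m+n∸m≡n; +-∸-assoc; m≤n⇒m∸n≡0; ≮⇒≥; ≤ᵇ-reflects-≤; m≤n⇒∃[o]m+o≡n; _!*_!≢0; _!≢0; m*n≢0)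
  open import Data.Nat.Tactic.RingSolver using (solve-∀)
  open import Data.Integer as ℤ using (ℤ; -1ℤ)
  open import Data.Integer.Properties using (pos-*)
  open import Data.Rational using (_/_; _+_; _*_)
  open import Data.Rational.Properties using (*-zeroˡ; neg-distribˡ-*)
  open import Data.Product using (∃; _,_)
  open import Relation.Nullary.Reflects using (ofʸ; ofⁿ)
  open import Relation.Binary.PropositionalEquality
  open ≡-Reasoning

  factorial-quotient≡multinomial : ∀ a b c →
    ℕ→ℚ ((a +ℕ b +ℕ c) !) /ℕ (a ! *ℕ b ! *ℕ c !) ≡ ℤ→ℚ (+ multinomial a b c)
  factorial-quotient≡multinomial a b c = begin
    ℕ→ℚ ((a +ℕ b +ℕ c) !) /ℕ F  ≡⟨ cong (λ m → ℕ→ℚ m /ℕ F) (a!*b!*c!*multinomial≡[a+b+c]! a b c) ⟨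
    ℤ→ℚ (+ (F *ℕ μ)) /ℕ F       ≡⟨ cong (λ i → ℤ→ℚ i /ℕ F) (pos-* F μ) ⟩
    ℤ→ℚ (+ F ℤ.* + μ) /ℕ F      ≡⟨ cong (_/ℕ F) (ℤ→ℚ-homo-* (+ F) (+ μ)) ⟩
    (ℕ→ℚ F * ℕ→ℚ μ) /ℕ F        ≡⟨ *-/ℕ-cancelˡ F (ℕ→ℚ μ) ⟩
    ℕ→ℚ μ                       ∎
    where
    F μ : ℕ
    F = a ! *ℕ b ! *ℕ c !
    μ = multinomial a b c
    instance
      F≢0 : ℕ.NonZero F
      F≢0 = m*n≢0 (a ! *ℕ b !) (c !) {{a !* b !≢0}} {{c !≢0}}

  multinomial-indices-sum : ∀ {c d e} → suc c ≤ d → suc c ≤ e →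
    d +ℕ e ∸ suc c ∸ 1 ≡ d ∸ suc c +ℕ (e ∸ suc c) +ℕ c
  multinomial-indices-sum {c} c<d c<e with m≤n⇒∃[o]m+o≡n c<d | m≤n⇒∃[o]m+o≡n c<e
  ... | a , refl | b , refl = begin
    suc c +ℕ a +ℕ (suc c +ℕ b) ∸ suc c ∸ 1             ≡⟨ cong (λ m → m ∸ suc c ∸ 1) (regroup a b c) ⟩
    suc c +ℕ suc (a +ℕ b +ℕ c) ∸ suc c ∸ 1             ≡⟨ cong (_∸ 1) (m+n∸m≡n (suc c) (suc (a +ℕ b +ℕ c))) ⟩
    a +ℕ b +ℕ c                                        ≡⟨ cong₂ (λ x y → x +ℕ y +ℕ c) (m+n∸m≡n (suc c) a) (m+n∸m≡n (suc c) b) ⟨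
    suc c +ℕ a ∸ suc c +ℕ (suc c +ℕ b ∸ suc c) +ℕ c    ∎
    where
    regroup : ∀ a b c → suc c +ℕ a +ℕ (suc c +ℕ b) ≡ suc c +ℕ suc (a +ℕ b +ℕ c)
    regroup = solve-∀

  g-coefficient : ∀ d e k → g (d +ℕ e) d k ≡ ℤ→ℚ (coefficient d e k)
  g-coefficient d e zero = refl
  g-coefficient d e (suc c) rewrite m+n∸m≡n d e
    with suc c ≤ᵇ d | ≤ᵇ-reflects-≤ (suc c) d | suc c ≤ᵇ e | ≤ᵇ-reflects-≤ (suc c) e
  ... | _ | ofⁿ c≮d | _ | _       rewrite m≤n⇒m∸n≡0 (≮⇒≥ c≮d) = refl
  ... | _ | ofʸ c<d | _ | ofⁿ c≮e rewrite +-∸-assoc 1 c<d | m≤n⇒m∸n≡0 (≮⇒≥ c≮e) = refl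
  ... | _ | ofʸ c<d | _ | ofʸ c<e rewrite +-∸-assoc 1 c<d | +-∸-assoc 1 c<e | multinomial-indices-sum c<d c<e =
    factorial-quotient≡multinomial (d ∸ suc c) (e ∸ suc c) c

  tX-deriv : ∀ p k → tX (deriv p) k ≡ ℕ→ℚ k * p k
  tX-deriv p zero    = sym (*-zeroˡ (p 0))
  tX-deriv p (suc k) = refl

  i+[d+j]≡d+[i+j] : ∀ i d j → i +ℕ (d +ℕ j) ≡ d +ℕ (i +ℕ j)
  i+[d+j]≡d+[i+j] = solve-∀

  i+[d+j]∸d≡i+j : ∀ i d j → i +ℕ (d +ℕ j) ∸ d ≡ i +ℕ j
  i+[d+j]∸d≡i+j i d j = trans (cong (_∸ d) (i+[d+j]≡d+[i+j] i d j)) (m+n∸m≡n d (i +ℕ j))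

  d+2≤n⇒n≡2+[d+j] : ∀ {d n} → d +ℕ 2 ≤ n → ∃ λ j → 2 +ℕ (d +ℕ j) ≡ n
  d+2≤n⇒n≡2+[d+j] {d} d+2≤n with m≤n⇒∃[o]m+o≡n d+2≤n
  ... | j , d+2+j≡n = j , trans (regroup d j) d+2+j≡n
    where
    regroup : ∀ d j → 2 +ℕ (d +ℕ j) ≡ d +ℕ 2 +ℕ j
    regroup = solve-∀

  g[i+[d+j]]≡coefficient : ∀ i d j k → g (i +ℕ (d +ℕ j)) d k ≡ ℤ→ℚ (coefficient d (i +ℕ j) k)
  g[i+[d+j]]≡coefficient i d j k = trans (cong (λ m → g m d k) (i+[d+j]≡d+[i+j] i d j)) (g-coefficient d (i +ℕ j) k)

  g-recurrence₁ : ∀ d j k → g (2 +ℕ (d +ℕ j)) d k ≡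
    (ℤ→ℚ (+ (2 *ℕ d) +ℤ + 1 -ℤ + (2 +ℕ (d +ℕ j))) /ℕ suc j) * tX (g (1 +ℕ (d +ℕ j)) d) k
    + (ℕ→ℚ (d +ℕ j) /ℕ suc j) * g (1 +ℕ (d +ℕ j)) d k
    + (ℕ→ℚ j /ℕ suc j) * tX (g (d +ℕ j) d) k
  g-recurrence₁ d j zero    =
    0≡p*0+q*0+r*0 (ℤ→ℚ (+ (2 *ℕ d) +ℤ + 1 -ℤ + (2 +ℕ (d +ℕ j))) /ℕ suc j)
                  (ℕ→ℚ (d +ℕ j) /ℕ suc j) (ℕ→ℚ j /ℕ suc j)
  g-recurrence₁ d j (suc z) =
    ℤ→ℚ-divide j (+ (2 *ℕ d) +ℤ + 1 -ℤ + (2 +ℕ (d +ℕ j))) (+ (d +ℕ j)) (+ j)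
      (g[i+[d+j]]≡coefficient 2 d j (suc z))
      (g[i+[d+j]]≡coefficient 1 d j z) (g[i+[d+j]]≡coefficient 1 d j (suc z)) (g[i+[d+j]]≡coefficient 0 d j z)
      (coefficient-recurrence₁ d j z)

  g-recurrence₂ : ∀ d j k → g (2 +ℕ (d +ℕ j)) d k ≡
    (ℕ→ℚ d /ℕ suc j) * tX (g (1 +ℕ (d +ℕ j)) d) k
    + (ℕ→ℚ (1 +ℕ (d +ℕ j)) /ℕ suc j) * g (1 +ℕ (d +ℕ j)) d k
    + (- (ℕ→ℚ 1 /ℕ suc j)) * (tX (tX (deriv (g (1 +ℕ (d +ℕ j)) d))) k + tX (deriv (g (1 +ℕ (d +ℕ j)) d)) k)
  g-recurrence₂ d j zero    =
    0≡p*0+q*0+r*0 (ℕ→ℚ d /ℕ suc j) (ℕ→ℚ (1 +ℕ (d +ℕ j)) /ℕ suc j) (- (ℕ→ℚ 1 /ℕ suc j))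
  g-recurrence₂ d j (suc z) = begin
    g (2 +ℕ (d +ℕ j)) d (suc z)
      ≡⟨ ℤ→ℚ-divide j (+ d) (+ suc (d +ℕ j)) -1ℤ
           (g[i+[d+j]]≡coefficient 2 d j (suc z))
           (g[i+[d+j]]≡coefficient 1 d j z) (g[i+[d+j]]≡coefficient 1 d j (suc z)) derivative-terms
           (coefficient-recurrence₂ d j z) ⟩
    (ℕ→ℚ d /ℕ suc j) * g′ z + (ℕ→ℚ (suc (d +ℕ j)) /ℕ suc j) * g′ (suc z) + (ℤ→ℚ -1ℤ /ℕ suc j) * D
      ≡⟨ cong (λ c → (ℕ→ℚ d /ℕ suc j) * g′ z + (ℕ→ℚ (suc (d +ℕ j)) /ℕ suc j) * g′ (suc z) + c * D)
              (neg-distribˡ-* (ℕ→ℚ 1) (+ 1 / suc j)) ⟨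
    (ℕ→ℚ d /ℕ suc j) * g′ z + (ℕ→ℚ (suc (d +ℕ j)) /ℕ suc j) * g′ (suc z) + (- (ℕ→ℚ 1 /ℕ suc j)) * D ∎
    where
    g′ : Poly
    g′ = g (1 +ℕ (d +ℕ j)) d
    D : ℚ
    D = tX (tX (deriv g′)) (suc z) + tX (deriv g′) (suc z)
    derivative-terms : D ≡ ℤ→ℚ (+ z ℤ.* coefficient d (suc j) z ℤ.+ + suc z ℤ.* coefficient d (suc j) (suc z))
    derivative-terms = begin
      tX (deriv g′) z + tX (deriv g′) (suc z)             ≡⟨ cong₂ _+_ (tX-deriv g′ z) (tX-deriv g′ (suc z)) ⟩
      ℕ→ℚ z * g′ z + ℕ→ℚ (suc z) * g′ (suc z)            ≡⟨ cong₂ (λ u v → ℕ→ℚ z * u + ℕ→ℚ (suc z) * v)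
                                                                   (g[i+[d+j]]≡coefficient 1 d j z) (g[i+[d+j]]≡coefficient 1 d j (suc z)) ⟩
      ℕ→ℚ z * ℤ→ℚ X + ℕ→ℚ (suc z) * ℤ→ℚ Y                ≡⟨ cong₂ _+_ (ℤ→ℚ-homo-* (+ z) X) (ℤ→ℚ-homo-* (+ suc z) Y) ⟨
      ℤ→ℚ (+ z ℤ.* X) + ℤ→ℚ (+ suc z ℤ.* Y)              ≡⟨ ℤ→ℚ-homo-+ (+ z ℤ.* X) (+ suc z ℤ.* Y) ⟨
      ℤ→ℚ (+ z ℤ.* X ℤ.+ + suc z ℤ.* Y)                  ∎
      where
      X Y : ℤ
      X = coefficient d (suc j) z
      Y = coefficient d (suc j) (suc z)

open GRecurrences

theorem2p1 : (n d : ℕ) → 1 ≤ d → d +ℕ 2 ≤ n →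
    ((k : ℕ) → g n d k ≡
      ( (ℤ→ℚ (+ (2 *ℕ d) +ℤ + 1 -ℤ + n) /ℕ (n ∸ d ∸ 1)) ⊙ tX (g (n ∸ 1) d)
      ⊕ (ℕ→ℚ (n ∸ 2) /ℕ (n ∸ d ∸ 1)) ⊙ g (n ∸ 1) d
      ⊕ (ℕ→ℚ (n ∸ d ∸ 2) /ℕ (n ∸ d ∸ 1)) ⊙ tX (g (n ∸ 2) d) ) k)
    ×
    ((k : ℕ) → g n d k ≡
      ( (ℕ→ℚ d /ℕ (n ∸ d ∸ 1)) ⊙ tX (g (n ∸ 1) d)
      ⊕ (ℕ→ℚ (n ∸ 1) /ℕ (n ∸ d ∸ 1)) ⊙ g (n ∸ 1) d
      ⊕ (- (ℕ→ℚ 1 /ℕ (n ∸ d ∸ 1))) ⊙ (tX (tX (deriv (g (n ∸ 1) d))) ⊕ tX (deriv (g (n ∸ 1) d))) ) k)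
theorem2p1 n d _ d+2≤n with d+2≤n⇒n≡2+[d+j] d+2≤n
... | j , refl rewrite cong (_∸ 1) (i+[d+j]∸d≡i+j 2 d j) | cong (_∸ 2) (i+[d+j]∸d≡i+j 2 d j) =
  g-recurrence₁ d j , g-recurrence₂ d j
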